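{- Let $(L_n)_{n\ge0}$ be the Lucas sequence and let $k\ge 1$. Let $\mathcal X_k$ be the set of positive integers of the form $L_k+\sum_{i\in I}L_i$ where $I$ is a finite (possibly empty) subset of $\{k+2,k+3,\ldots\}$ containing no two consecutive integers, and let $q_k(1)<q_k(2)<\cdots$ be its elements in increasing order. Let $S$ be the golden string. Then for every $j\ge 1$, $$q_k(j+1)-q_k(j)=\begin{cases}L_{k+1},&\text{if the $j$th character of $S$ is $A$},\\ L_{k+2},&\text{if the $j$th character of $S$ is $B$}.\end{cases}$$
   Context: $L_0=2$, $L_1=1$, $L_n=L_{n-1}+L_{n-2}$ ($n\ge2$). Equivalently, $\mathcal X_k$ is the set of positive integers whose unique representation as a sum of Lucas numbers with pairwise non-consecutive indices, not using both $L_0$ and $L_2$, has $L_k$ as smallest summand. The golden string $S=BABBABABBABBA\ldots$ is the infinite string over $\{A,B\}$ defined by $S_1=A$, $S_2=B$, $S_k=S_{k-1}S_{k-2}$ (concatenation) for $k\ge3$; each $S_k$ ($k\ge2$) is a prefix of $S_{k+1}$ and $S$ is the limit string. -}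

module Defs where

open import Data.Nat using (ℕ; zero; suc; _+_; _≤_; _<_)
open import Data.List using (List; []; _∷_; _++_; map)
open import Data.Nat.ListAction using (sum)
open import Data.Maybe using (Maybe; just; nothing; fromMaybe)
open import Data.Product using (Σ; _×_; ∃)
open import Data.Unit using (⊤)
open import Relation.Binary.PropositionalEquality using (_≡_)

L : ℕ → ℕ
L zero = 2
L (suc zero) = 1
L (suc (suc n)) = L (suc n) + L n

-- Such lists are exactly the finite subsets of {m, m+1, ...} with no two consecutive integers.
Sep : ℕ → List ℕ → Set
Sep m [] = ⊤
Sep m (i ∷ is) = (m ≤ i) × Sep (suc (suc i)) is

InX : ℕ → ℕ → Set
InX k x = Σ (List ℕ) (λ I → Sep (k + 2) I × (x ≡ L k + sum (map L I)))

-- q is the increasing enumeration of 𝒳_k, indexed from 0: q 0 = q_k(1), q 1 = q_k(2), ...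
IsEnum : ℕ → (ℕ → ℕ) → Set
IsEnum k q = (∀ j → q j < q (suc j)) × (∀ x → InX k x → ∃ λ j → q j ≡ x) × (∀ j → InX k (q j))

data AB : Set where
  A B : AB

Sw : ℕ → List AB
Sw zero = []
Sw (suc zero) = A ∷ []
Sw (suc (suc zero)) = B ∷ []
Sw (suc (suc (suc n))) = Sw (suc (suc n)) ++ Sw (suc n)

nth : {X : Set} → List X → ℕ → Maybe X
nth [] _ = nothing
nth (x ∷ xs) zero = just x
nth (x ∷ xs) (suc i) = nth xs i

-- j-th character (1-based) of the infinite golden string S.
-- S_{j+2} has length F_{j+1} ≥ j and is a prefix of S, so its j-th letter is S's j-th letter.
-- (The default A is never used for j ≥ 1.)
goldenChar : ℕ → AB
goldenChar zero = A
goldenChar (suc i) = fromMaybe A (nth (Sw (suc i + 2)) i)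

-- Write X(n) for the elements of 𝒳_k all of whose indices are at most n + k. Splitting on whether the
-- index n + k + 2 occurs gives X(n+2) = X(n+1) ∪ (L_{n+k+2} + X(n)). On the other side, if w_n is S_{n+1}
-- with its last letter removed, then w_{n+2} = w_{n+1} c w_n with c the last letter of S_{n+2}, and the
-- letters of S_{n+2}, read as A ↦ L_{k+1} and B ↦ L_{k+2}, add up to L_{n+k+2}. So, by induction on n,
-- the running sums of w_n starting from L_k list X(n) in increasing order. Every w_n is a prefix of S,
-- which yields an increasing enumeration of 𝒳_k with the claimed gaps, and such an enumeration is unique.

module Submission where

open import Defs
open import Data.Nat using (ℕ; zero; suc; _+_; _∸_; _≤_; _<_; _≤′_; ≤′-refl; ≤′-step; z≤n; s≤s; s≤s⁻¹; _<?_)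
open import Data.Nat.Properties
open import Data.Nat.ListAction using (sum)
open import Data.Nat.ListAction.Properties using (sum-++)
open import Data.Nat.Induction using (<-rec)
open import Data.List using (List; []; _∷_; _++_; map; length; applyUpTo)
open import Data.List.Properties using (++-assoc; ++-identityʳ; map-++; length-++; length-++-≤ˡ; map-applyUpTo)
open import Data.List.Membership.Propositional using (_∈_)
open import Data.List.Relation.Unary.Any using (here)
open import Data.List.Membership.Propositional.Properties
  using (∈-++⁺ˡ; ∈-++⁺ʳ; ∈-++⁻; ∈-map⁺; ∈-map⁻; ∈-applyUpTo⁺; ∈-applyUpTo⁻)
open import Data.Maybe using (just; nothing)
open import Data.Maybe.Properties using (just-injective)
open import Data.Product using (_×_; ∃; _,_)
open import Data.Sum using (_⊎_; inj₁; inj₂)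
open import Data.Unit using (⊤; tt)
open import Data.Empty using (⊥-elim)
open import Function using (_∘_)
open import Relation.Nullary using (yes; no)
open import Relation.Binary.PropositionalEquality
open import Algebra.Properties.CommutativeSemigroup +-commutativeSemigroup using (xy∙z≈xz∙y)

nth-++ˡ : {X : Set} (xs ys : List X) (i : ℕ) {x : X} → nth xs i ≡ just x → nth (xs ++ ys) i ≡ just x
nth-++ˡ (_ ∷ _)  ys zero    eq = eq
nth-++ˡ (_ ∷ xs) ys (suc i) eq = nth-++ˡ xs ys i eq

nth-defined : {X : Set} (xs : List X) (i : ℕ) → i < length xs → ∃ λ x → nth xs i ≡ just x
nth-defined (x ∷ _)  zero    _         = x , refl
nth-defined (_ ∷ xs) (suc i) (s≤s i<n) = nth-defined xs i i<n

nth⇒applyUpTo : {X : Set} (f : ℕ → X) (xs : List X) →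
  (∀ i {x} → nth xs i ≡ just x → f i ≡ x) → xs ≡ applyUpTo f (length xs)
nth⇒applyUpTo f []       _    = refl
nth⇒applyUpTo f (x ∷ xs) f≈xs =
  cong₂ _∷_ (sym (f≈xs 0 refl)) (nth⇒applyUpTo (f ∘ suc) xs (f≈xs ∘ suc))

runningSums : ℕ → List ℕ → List ℕ
runningSums s []       = s ∷ []
runningSums s (g ∷ gs) = s ∷ runningSums (s + g) gs

runningSum : (ℕ → ℕ) → ℕ → ℕ → ℕ
runningSum g s zero    = s
runningSum g s (suc j) = runningSum (g ∘ suc) (s + g 0) j

runningSum-suc : ∀ g s j → runningSum g s (suc j) ≡ runningSum g s j + g j
runningSum-suc g s zero    = refl
runningSum-suc g s (suc j) = runningSum-suc (g ∘ suc) (s + g 0) j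

runningSums-applyUpTo : ∀ g s m → runningSums s (applyUpTo g m) ≡ applyUpTo (runningSum g s) (suc m)
runningSums-applyUpTo g s zero    = refl
runningSums-applyUpTo g s (suc m) = cong (s ∷_) (runningSums-applyUpTo (g ∘ suc) (s + g 0) m)

runningSums-++-∷ : ∀ s us g vs →
  runningSums s (us ++ g ∷ vs) ≡ runningSums s us ++ runningSums (s + sum us + g) vs
runningSums-++-∷ s []       g vs = cong (λ t → s ∷ runningSums (t + g) vs) (sym (+-identityʳ s))
runningSums-++-∷ s (u ∷ us) g vs = cong (s ∷_) (begin
  runningSums (s + u) (us ++ g ∷ vs)
    ≡⟨ runningSums-++-∷ (s + u) us g vs ⟩
  runningSums (s + u) us ++ runningSums (s + u + sum us + g) vs
    ≡⟨ cong (λ t → runningSums (s + u) us ++ runningSums (t + g) vs) (+-assoc s u (sum us)) ⟩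
  runningSums (s + u) us ++ runningSums (s + (u + sum us) + g) vs ∎)
  where open ≡-Reasoning

map-+-runningSums : ∀ t s gs → map (_+ t) (runningSums s gs) ≡ runningSums (s + t) gs
map-+-runningSums t s []       = refl
map-+-runningSums t s (g ∷ gs) = cong ((s + t) ∷_) (begin
  map (_+ t) (runningSums (s + g) gs) ≡⟨ map-+-runningSums t (s + g) gs ⟩
  runningSums (s + g + t) gs          ≡⟨ cong (λ u → runningSums u gs) (xy∙z≈xz∙y s g t) ⟩
  runningSums (s + t + g) gs          ∎)
  where open ≡-Reasoning

Increasing : (ℕ → ℕ) → Set
Increasing f = ∀ j → f j < f (suc j)

increasing⇒strictMono : ∀ {f} → Increasing f → ∀ {i j} → i < j → f i < f j
increasing⇒strictMono f-inc {i} {suc j} (s≤s i≤j) with m≤n⇒m<n∨m≡n i≤j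
... | inj₁ i<j  = <-trans (increasing⇒strictMono f-inc i<j) (f-inc j)
... | inj₂ refl = f-inc j

increasing⇒mono : ∀ {f} → Increasing f → ∀ {i j} → i ≤ j → f i ≤ f j
increasing⇒mono f-inc i≤j with m≤n⇒m<n∨m≡n i≤j
... | inj₁ i<j  = <⇒≤ (increasing⇒strictMono f-inc i<j)
... | inj₂ refl = ≤-refl

-- f j = g a with j ≤ a, since a < j would give f a = g a = f j.
≤-of-agree-below : ∀ {f g} → Increasing f → Increasing g → (∀ j → ∃ λ a → g a ≡ f j) →
  ∀ j → (∀ {i} → i < j → f i ≡ g i) → g j ≤ f j
≤-of-agree-below {f} {g} f-inc g-inc f⊆g j agree with f⊆g j
... | a , ga≡fj with a <? j
...   | yes a<j = ⊥-elim (<-irrefl (trans (agree a<j) ga≡fj) (increasing⇒strictMono f-inc a<j))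
...   | no  a≮j = subst (g j ≤_) ga≡fj (increasing⇒mono g-inc (≮⇒≥ a≮j))

increasing-sameRange⇒≡ : ∀ {f g} → Increasing f → Increasing g →
  (∀ j → ∃ λ a → g a ≡ f j) → (∀ j → ∃ λ a → f a ≡ g j) → ∀ j → f j ≡ g j
increasing-sameRange⇒≡ {f} {g} f-inc g-inc f⊆g g⊆f = <-rec (λ j → f j ≡ g j) λ j agree →
  ≤-antisym (≤-of-agree-below g-inc f-inc g⊆f j (sym ∘ agree))
            (≤-of-agree-below f-inc g-inc f⊆g j agree)

Sw-prefix : ∀ {m n} → m ≤′ n → ∃ λ t → Sw (suc (suc n)) ≡ Sw (suc (suc m)) ++ t
Sw-prefix {m} ≤′-refl = [] , sym (++-identityʳ (Sw (suc (suc m))))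
Sw-prefix {m} (≤′-step {n} m≤′n) with Sw-prefix m≤′n
... | t , eq = t ++ Sw (suc n) , (begin
  Sw (suc (suc n)) ++ Sw (suc n)         ≡⟨ cong (_++ Sw (suc n)) eq ⟩
  (Sw (suc (suc m)) ++ t) ++ Sw (suc n)  ≡⟨ ++-assoc (Sw (suc (suc m))) t (Sw (suc n)) ⟩
  Sw (suc (suc m)) ++ t ++ Sw (suc n)    ∎)
  where open ≡-Reasoning

lastLetter : ℕ → AB
lastLetter zero          = A
lastLetter (suc zero)    = B
lastLetter (suc (suc n)) = lastLetter n

Sw⁻ : ℕ → List AB
Sw⁻ zero          = []
Sw⁻ (suc zero)    = []
Sw⁻ (suc (suc n)) = Sw⁻ (suc n) ++ lastLetter (suc n) ∷ Sw⁻ n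

Sw-split : ∀ n → Sw (suc n) ≡ Sw⁻ n ++ lastLetter n ∷ []
Sw-split zero          = refl
Sw-split (suc zero)    = refl
Sw-split (suc (suc n)) = begin
  Sw (suc (suc n)) ++ Sw (suc n)
    ≡⟨ cong₂ _++_ (Sw-split (suc n)) (Sw-split n) ⟩
  (u ++ x ∷ []) ++ v ++ y ∷ []  ≡⟨ ++-assoc u (x ∷ []) (v ++ y ∷ []) ⟩
  u ++ x ∷ v ++ y ∷ []          ≡⟨ ++-assoc u (x ∷ v) (y ∷ []) ⟨
  (u ++ x ∷ v) ++ y ∷ []        ∎
  where
  open ≡-Reasoning
  u = Sw⁻ (suc n)
  v = Sw⁻ n
  x = lastLetter (suc n)
  y = lastLetter n

length-Sw⁻ : ∀ n → n ≤ length (Sw⁻ (suc n))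
length-Sw⁻ zero          = z≤n
length-Sw⁻ (suc zero)    = s≤s z≤n
length-Sw⁻ (suc (suc n)) = begin
  suc (suc n)                               ≤⟨ s≤s (≤-trans (length-Sw⁻ (suc n)) (m≤m+n _ _)) ⟩
  suc (length u + length v)                 ≡⟨ +-suc (length u) (length v) ⟨
  length u + length (lastLetter (suc (suc n)) ∷ v)  ≡⟨ length-++ u ⟨
  length (Sw⁻ (suc (suc (suc n))))          ∎
  where
  open ≤-Reasoning
  u = Sw⁻ (suc (suc n))
  v = Sw⁻ (suc n)

length-Sw : ∀ n → n ≤ length (Sw (suc (suc n)))
length-Sw n = begin
  n                                                        ≤⟨ length-Sw⁻ n ⟩
  length (Sw⁻ (suc n))                                     ≤⟨ length-++-≤ˡ (Sw⁻ (suc n)) ⟩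
  length (Sw⁻ (suc n) ++ lastLetter (suc n) ∷ [])          ≡⟨ cong length (Sw-split (suc n)) ⟨
  length (Sw (suc (suc n)))                                ∎
  where open ≤-Reasoning

nth-Sw-goldenChar : ∀ i → nth (Sw (suc (suc (suc i)))) i ≡ just (goldenChar (suc i))
nth-Sw-goldenChar i rewrite +-comm i 2
  with nth (Sw (suc (suc (suc i)))) i | nth-defined (Sw (suc (suc (suc i)))) i (length-Sw (suc i))
... | just _  | _      = refl
... | nothing | _ , ()

goldenChar-Sw : ∀ m i {x} → nth (Sw (suc (suc m))) i ≡ just x → goldenChar (suc i) ≡ x
goldenChar-Sw m i {x} nth≡x
  with Sw-prefix (≤⇒≤′ (m≤m+n m (suc i))) | Sw-prefix (≤⇒≤′ (m≤n+m (suc i) m))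
... | t , eq | t′ , eq′ = just-injective (begin
  just (goldenChar (suc i))                 ≡⟨ nth-++ˡ (Sw (suc (suc (suc i)))) t′ i (nth-Sw-goldenChar i) ⟨
  nth (Sw (suc (suc (suc i))) ++ t′) i      ≡⟨ cong (λ w → nth w i) eq′ ⟨
  nth (Sw (suc (suc (m + suc i)))) i        ≡⟨ cong (λ w → nth w i) eq ⟩
  nth (Sw (suc (suc m)) ++ t) i             ≡⟨ nth-++ˡ (Sw (suc (suc m))) t i nth≡x ⟩
  just x                                    ∎)
  where open ≡-Reasoning

Sw⁻-golden : ∀ n → Sw⁻ n ≡ applyUpTo (goldenChar ∘ suc) (length (Sw⁻ n))
Sw⁻-golden zero    = refl
Sw⁻-golden (suc m) = nth⇒applyUpTo (goldenChar ∘ suc) (Sw⁻ (suc m)) λ i nth≡x →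
  goldenChar-Sw m i (subst (λ w → nth w i ≡ _) (sym (Sw-split (suc m)))
    (nth-++ˡ (Sw⁻ (suc m)) (lastLetter (suc m) ∷ []) i nth≡x))

+-sum-map-∷ʳ : {X : Set} (f : X → ℕ) (s : ℕ) (xs : List X) (x : X) →
  s + sum (map f xs) + f x ≡ s + sum (map f (xs ++ x ∷ []))
+-sum-map-∷ʳ f s xs x = begin
  s + sum (map f xs) + f x                        ≡⟨ +-assoc s _ (f x) ⟩
  s + (sum (map f xs) + f x)                      ≡⟨ cong (λ y → s + (sum (map f xs) + y)) (+-identityʳ (f x)) ⟨
  s + (sum (map f xs) + sum (f x ∷ []))           ≡⟨ cong (s +_) (sum-++ (map f xs) (f x ∷ [])) ⟨
  s + sum (map f xs ++ f x ∷ [])                  ≡⟨ cong (λ ys → s + sum ys) (map-++ f xs (x ∷ [])) ⟨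
  s + sum (map f (xs ++ x ∷ []))                  ∎
  where open ≡-Reasoning

SepBelow : ℕ → ℕ → List ℕ → Set
SepBelow a b []       = ⊤
SepBelow a b (i ∷ is) = (a ≤ i) × (i < b) × SepBelow (suc (suc i)) b is

SepBelow⇒Sep : ∀ {a b} I → SepBelow a b I → Sep a I
SepBelow⇒Sep []       _               = tt
SepBelow⇒Sep (i ∷ is) (a≤i , _ , sep) = a≤i , SepBelow⇒Sep is sep

SepBelow-mono : ∀ {a b b′} I → b ≤ b′ → SepBelow a b I → SepBelow a b′ I
SepBelow-mono []       _    _                 = tt
SepBelow-mono (i ∷ is) b≤b′ (a≤i , i<b , sep) = a≤i , <-≤-trans i<b b≤b′ , SepBelow-mono is b≤b′ sep

Sep⇒SepBelow : ∀ {a} I → Sep a I → ∃ λ b → SepBelow a b I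
Sep⇒SepBelow []       _           = 0 , tt
Sep⇒SepBelow (i ∷ is) (a≤i , sep) with Sep⇒SepBelow is sep
... | b , sep′ = suc i + b , a≤i , s≤s (m≤m+n i b) , SepBelow-mono is (m≤n+m b (suc i)) sep′

SepBelow-≤⇒[] : ∀ {a b} I → b ≤ a → SepBelow a b I → I ≡ []
SepBelow-≤⇒[] []      _   _               = refl
SepBelow-≤⇒[] (i ∷ _) b≤a (a≤i , i<b , _) = ⊥-elim (<-irrefl refl (<-≤-trans i<b (≤-trans b≤a a≤i)))

SepBelow-∷ʳ : ∀ {a c} I → a ≤ suc c → SepBelow a c I → SepBelow a (suc (suc c)) (I ++ suc c ∷ [])
SepBelow-∷ʳ []       a≤c+1 _                 = a≤c+1 , ≤-refl , tt
SepBelow-∷ʳ (i ∷ is) _     (a≤i , i<c , sep) =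
  a≤i , m<n⇒m<1+n (m<n⇒m<1+n i<c) , SepBelow-∷ʳ is (s≤s i<c) sep

SepBelow-split : ∀ {a c} I → SepBelow a (suc (suc c)) I →
  SepBelow a (suc c) I ⊎ ∃ λ I′ → I ≡ I′ ++ suc c ∷ [] × a ≤ suc c × SepBelow a c I′
SepBelow-split []       _                   = inj₁ tt
SepBelow-split {c = c} (i ∷ is) (a≤i , i<c+2 , sep) with SepBelow-split is sep
... | inj₂ (I′ , refl , i+2≤c+1 , sep′) =
  inj₂ (i ∷ I′ , refl , ≤-trans a≤i (m<n⇒m≤1+n i<c) , a≤i , i<c , sep′)
  where
  i<c : i < c
  i<c = s≤s⁻¹ i+2≤c+1
... | inj₁ sep′ with i <? suc c
...   | yes i<c+1 = inj₁ (a≤i , i<c+1 , sep′)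
...   | no  i≮c+1 with refl ← ≤-antisym (s≤s⁻¹ i<c+2) (≮⇒≥ i≮c+1)
                  with refl ← SepBelow-≤⇒[] is (m≤n+m (suc c) 2) sep′ = inj₂ ([] , refl , a≤i , tt)

L-positive : ∀ n → 0 < L n
L-positive zero          = s≤s z≤n
L-positive (suc zero)    = s≤s z≤n
L-positive (suc (suc n)) = <-≤-trans (L-positive (suc n)) (m≤m+n _ _)

module _ (k : ℕ) where

  gap : AB → ℕ
  gap A = L (suc k)
  gap B = L (suc (suc k))

  gap-positive : ∀ c → 0 < gap c
  gap-positive A = L-positive (suc k)
  gap-positive B = L-positive (suc (suc k))

  sum-gap-Sw : ∀ n → sum (map gap (Sw (suc (suc n)))) ≡ L (suc (suc (n + k)))
  sum-gap-Sw zero          = +-identityʳ (L (suc (suc k)))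
  sum-gap-Sw (suc zero)    = cong (L (suc (suc k)) +_) (+-identityʳ (L (suc k)))
  sum-gap-Sw (suc (suc n)) = begin
    sum (map gap (Sw (suc (suc (suc n))) ++ Sw (suc (suc n))))
      ≡⟨ cong sum (map-++ gap (Sw (suc (suc (suc n)))) (Sw (suc (suc n)))) ⟩
    sum (map gap (Sw (suc (suc (suc n)))) ++ map gap (Sw (suc (suc n))))
      ≡⟨ sum-++ (map gap (Sw (suc (suc (suc n))))) (map gap (Sw (suc (suc n)))) ⟩
    sum (map gap (Sw (suc (suc (suc n))))) + sum (map gap (Sw (suc (suc n))))
      ≡⟨ cong₂ _+_ (sum-gap-Sw (suc n)) (sum-gap-Sw n) ⟩
    L (suc (suc (suc (n + k)))) + L (suc (suc (n + k)))  ∎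
    where open ≡-Reasoning

  block : ℕ → List ℕ
  block n = runningSums (L k) (map gap (Sw⁻ n))

  block-rec : ∀ n → block (suc (suc n)) ≡ block (suc n) ++ map (_+ L (suc (suc (n + k)))) (block n)
  block-rec n = begin
    runningSums (L k) (map gap (u ++ x ∷ Sw⁻ n))
      ≡⟨ cong (runningSums (L k)) (map-++ gap u (x ∷ Sw⁻ n)) ⟩
    runningSums (L k) (map gap u ++ gap x ∷ map gap (Sw⁻ n))
      ≡⟨ runningSums-++-∷ (L k) (map gap u) (gap x) (map gap (Sw⁻ n)) ⟩
    block (suc n) ++ runningSums (L k + sum (map gap u) + gap x) (map gap (Sw⁻ n))
      ≡⟨ cong (λ s → block (suc n) ++ runningSums s (map gap (Sw⁻ n))) step ⟩
    block (suc n) ++ runningSums (L k + L (suc (suc (n + k)))) (map gap (Sw⁻ n))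
      ≡⟨ cong (block (suc n) ++_) (map-+-runningSums (L (suc (suc (n + k)))) (L k) (map gap (Sw⁻ n))) ⟨
    block (suc n) ++ map (_+ L (suc (suc (n + k)))) (block n)  ∎
    where
    open ≡-Reasoning
    u = Sw⁻ (suc n)
    x = lastLetter (suc n)
    step : L k + sum (map gap u) + gap x ≡ L k + L (suc (suc (n + k)))
    step = begin
      L k + sum (map gap u) + gap x           ≡⟨ +-sum-map-∷ʳ gap (L k) u x ⟩
      L k + sum (map gap (u ++ x ∷ []))       ≡⟨ cong (λ w → L k + sum (map gap w)) (Sw-split (suc n)) ⟨
      L k + sum (map gap (Sw (suc (suc n))))  ≡⟨ cong (L k +_) (sum-gap-Sw n) ⟩
      L k + L (suc (suc (n + k)))             ∎

  InXUpTo : ℕ → ℕ → Set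
  InXUpTo n x = ∃ λ I → SepBelow (k + 2) (suc (n + k)) I × x ≡ L k + sum (map L I)

  InXUpTo⇒InX : ∀ {n x} → InXUpTo n x → InX k x
  InXUpTo⇒InX (I , sep , eq) = I , SepBelow⇒Sep I sep , eq

  InX⇒InXUpTo : ∀ {x} → InX k x → ∃ λ n → InXUpTo n x
  InX⇒InXUpTo (I , sep , eq) with b , sep′ ← Sep⇒SepBelow I sep =
    b , I , SepBelow-mono I (m≤n⇒m≤1+n (m≤m+n b k)) sep′ , eq

  InXUpTo-mono : ∀ {m n x} → m ≤ n → InXUpTo m x → InXUpTo n x
  InXUpTo-mono m≤n (I , sep , eq) = I , SepBelow-mono I (s≤s (+-monoˡ-≤ k m≤n)) sep , eq

  InXUpTo-+L : ∀ {n y} → InXUpTo n y → InXUpTo (suc (suc n)) (y + L (suc (suc (n + k))))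
  InXUpTo-+L {n} (I , sep , refl) =
    I ++ suc (suc (n + k)) ∷ [] ,
    SepBelow-∷ʳ I (subst (_≤ suc (suc (n + k))) (+-comm 2 k) (s≤s (s≤s (m≤n+m k n)))) sep ,
    +-sum-map-∷ʳ L (L k) I (suc (suc (n + k)))

  InXUpTo-≤1 : ∀ {n x} → n ≤ 1 → InXUpTo n x → x ≡ L k
  InXUpTo-≤1 {n} n≤1 (I , sep , refl)
    with refl ← SepBelow-≤⇒[] I (subst (suc (n + k) ≤_) (+-comm 2 k) (s≤s (+-monoˡ-≤ k n≤1))) sep
    = +-identityʳ (L k)

  block⊆InXUpTo-step : ∀ n →
    (∀ {x} → x ∈ block (suc n) → InXUpTo (suc n) x) → (∀ {x} → x ∈ block n → InXUpTo n x) →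
    ∀ {x} → x ∈ block (suc (suc n)) → InXUpTo (suc (suc n)) x
  block⊆InXUpTo-step n ih₁ ih₀ {x} x∈ with ∈-++⁻ (block (suc n)) (subst (x ∈_) (block-rec n) x∈)
  ... | inj₁ x∈′ = InXUpTo-mono (n≤1+n (suc n)) (ih₁ x∈′)
  ... | inj₂ x∈′ with ∈-map⁻ (_+ L (suc (suc (n + k)))) x∈′
  ...   | y , y∈ , refl = InXUpTo-+L (ih₀ y∈)

  block⊆InXUpTo : ∀ n {x} → x ∈ block n → InXUpTo n x
  block⊆InXUpTo zero          (here refl) = [] , tt , sym (+-identityʳ (L k))
  block⊆InXUpTo (suc zero)    (here refl) = [] , tt , sym (+-identityʳ (L k))
  block⊆InXUpTo (suc (suc n)) = block⊆InXUpTo-step n (block⊆InXUpTo (suc n)) (block⊆InXUpTo n)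

  InXUpTo⊆block-step : ∀ n →
    (∀ {x} → InXUpTo (suc n) x → x ∈ block (suc n)) → (∀ {x} → InXUpTo n x → x ∈ block n) →
    ∀ {x} → InXUpTo (suc (suc n)) x → x ∈ block (suc (suc n))
  InXUpTo⊆block-step n ih₁ ih₀ {x} (I , sep , eq) rewrite block-rec n with SepBelow-split I sep
  ... | inj₁ sep′                   = ∈-++⁺ˡ (ih₁ (I , sep′ , eq))
  ... | inj₂ (I′ , refl , _ , sep′) = ∈-++⁺ʳ (block (suc n))
    (subst (_∈ map (_+ L c) (block n)) (trans (+-sum-map-∷ʳ L (L k) I′ c) (sym eq))
      (∈-map⁺ (_+ L c) (ih₀ (I′ , sep′ , refl))))
    where c = suc (suc (n + k))

  InXUpTo⊆block : ∀ n {x} → InXUpTo n x → x ∈ block n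
  InXUpTo⊆block zero          x∈X = here (InXUpTo-≤1 z≤n x∈X)
  InXUpTo⊆block (suc zero)    x∈X = here (InXUpTo-≤1 ≤-refl x∈X)
  InXUpTo⊆block (suc (suc n)) = InXUpTo⊆block-step n (InXUpTo⊆block (suc n)) (InXUpTo⊆block n)

  gapAt : ℕ → ℕ
  gapAt j = gap (goldenChar (suc j))

  q : ℕ → ℕ
  q = runningSum gapAt (L k)

  block≡applyUpTo-q : ∀ n → block n ≡ applyUpTo q (suc (length (Sw⁻ n)))
  block≡applyUpTo-q n = begin
    runningSums (L k) (map gap (Sw⁻ n))
      ≡⟨ cong (runningSums (L k) ∘ map gap) (Sw⁻-golden n) ⟩
    runningSums (L k) (map gap (applyUpTo (goldenChar ∘ suc) (length (Sw⁻ n))))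
      ≡⟨ cong (runningSums (L k)) (map-applyUpTo (goldenChar ∘ suc) gap (length (Sw⁻ n))) ⟩
    runningSums (L k) (applyUpTo gapAt (length (Sw⁻ n)))
      ≡⟨ runningSums-applyUpTo gapAt (L k) (length (Sw⁻ n)) ⟩
    applyUpTo q (suc (length (Sw⁻ n)))  ∎
    where open ≡-Reasoning

  q-increasing : Increasing q
  q-increasing j =
    subst (q j <_) (sym (runningSum-suc gapAt (L k) j)) (m<m+n (q j) (gap-positive (goldenChar (suc j))))

  q∈block : ∀ j → q j ∈ block (suc j)
  q∈block j = subst (q j ∈_) (sym (block≡applyUpTo-q (suc j))) (∈-applyUpTo⁺ q (s≤s (length-Sw⁻ j)))

  q∈X : ∀ j → InX k (q j)
  q∈X j = InXUpTo⇒InX (block⊆InXUpTo (suc j) (q∈block j))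

  X⊆q : ∀ x → InX k x → ∃ λ j → q j ≡ x
  X⊆q x x∈X with n , x∈Xₙ ← InX⇒InXUpTo x∈X
    with j , _ , refl ← ∈-applyUpTo⁻ q (subst (x ∈_) (block≡applyUpTo-q n) (InXUpTo⊆block n x∈Xₙ))
    = j , refl

  q-isEnum : IsEnum k q
  q-isEnum = q-increasing , X⊆q , q∈X

  IsEnum⇒≡q : ∀ {p} → IsEnum k p → ∀ j → p j ≡ q j
  IsEnum⇒≡q {p} (p-increasing , X⊆p , p∈X) =
    increasing-sameRange⇒≡ p-increasing q-increasing (λ j → X⊆q (p j) (p∈X j)) (λ j → X⊆p (q j) (q∈X j))

  IsEnum⇒gap : ∀ {p} → IsEnum k p → ∀ j → p (suc j) ∸ p j ≡ gap (goldenChar (suc j))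
  IsEnum⇒gap {p} p-isEnum j = begin
    p (suc j) ∸ p j            ≡⟨ cong₂ _∸_ (IsEnum⇒≡q p-isEnum (suc j)) (IsEnum⇒≡q p-isEnum j) ⟩
    q (suc j) ∸ q j            ≡⟨ cong (_∸ q j) (runningSum-suc gapAt (L k) j) ⟩
    q j + gapAt j ∸ q j        ≡⟨ m+n∸m≡n (q j) (gapAt j) ⟩
    gap (goldenChar (suc j))   ∎
    where open ≡-Reasoning

-- The argument does not need 1 ≤ k.
lemma4p4 : (k : ℕ) → 1 ≤ k →
    (∃ λ q → IsEnum k q) ×
    (∀ q → IsEnum k q → ∀ j → 1 ≤ j →
      (goldenChar j ≡ A → q j ∸ q (j ∸ 1) ≡ L (k + 1)) ×
      (goldenChar j ≡ B → q j ∸ q (j ∸ 1) ≡ L (k + 2)))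
lemma4p4 k _ = (q k , q-isEnum k) , λ where
  p p-isEnum (suc j) _ →
    (λ isA → trans (IsEnum⇒gap k p-isEnum j) (trans (cong (gap k) isA) (cong L (+-comm 1 k)))) ,
    (λ isB → trans (IsEnum⇒gap k p-isEnum j) (trans (cong (gap k) isB) (cong L (+-comm 2 k))))
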